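{- Let $q$ be a prime power. In $\Lambda_{5,q}$ there is a cycle of type $(u_1,v_1,\dots,u_5,v_5)$ with $v_2+v_3=0$ if and only if there exist $c,d,r\in\mathbb{F}_q^*$ with $c\notin\{ -d,-2d\}$ such that $v_1=c+d$, $v_2=-c$, $v_3=c$, $v_4=d$, $v_5=-c-2d$ and $u_1=cr$, $u_2=dr$, $u_3=-(c+2d)r$, $u_4=(c+d)r$, $u_5=-cr$.
   Context: For a prime power $q$ and integer $k\ge2$, $\Lambda_{k,q}$ is the bipartite graph with vertex set $L_k\cup R_k$ (regarded as disjoint), where $L_k$ is the set of vectors $[l]=(l_0,\dots,l_k)\in\mathbb{F}_q^{k+1}$ with $l_1=l_2$ and $R_k$ the set of vectors $\langle r\rangle=(r_0,\dots,r_k)\in\mathbb{F}_q^{k+1}$ with $r_1=0$; edges join only $L_k$ to $R_k$, and $[l]\sim\langle r\rangle$ iff for every $2\le i\le k$: $l_i+r_i=r_0l_{i-2}$ if $i\equiv2,3\pmod4$, and $l_i+r_i=l_0r_{i-2}$ if $i\equiv0,1\pmod4$. A cycle of length $2n$ through the edge joining the two all-zero vectors is written $[l^{(1)}],\langle r^{(1)}\rangle,\dots,[l^{(n)}],\langle r^{(n)}\rangle$ (distinct vertices, consecutive ones adjacent, $\langle r^{(n)}\rangle\sim[l^{(1)}]$) with $[l^{(1)}]$ and $\langle r^{(1)}\rangle$ the all-zero vectors. Put $x_i=l^{(i)}_0$, $y_i=r^{(i)}_0$ ($1\le i\le n$), $x_{n+1}=y_{n+1}=0$, $u_i=x_{i+1}-x_i$,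 $v_i=y_{i+1}-y_i$; the tuple $(u_1,v_1,\dots,u_n,v_n)$ is the type of the cycle, and "there is a cycle of type $\epsilon$" means such a cycle with type $\epsilon$ exists. -}

module Defs where

open import Data.Nat using (ℕ; zero; suc; _≤_; _<_; _^_; _%_; _<?_)
open import Data.Nat.Primality using (Prime)
open import Data.Fin using (Fin; toℕ; fromℕ<) renaming (zero to fzero)
open import Data.Bool using (Bool; true; false; if_then_else_)
open import Data.Product using (Σ; ∃; _×_; _,_)
open import Relation.Nullary using (¬_; yes; no)
open import Relation.Binary.PropositionalEquality using (_≡_; _≢_)
open import Algebra.Structures using (IsCommutativeRing)
open import Function.Bundles using (_↔_)

IsPrimePower : ℕ → Set
IsPrimePower q = Σ ℕ λ p → Σ ℕ λ e → Prime p × 1 ≤ e × q ≡ p ^ e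

record FiniteField (q : ℕ) : Set₁ where
  infixl 7 _*_
  infixl 6 _+_
  infix 8 -_
  field
    Carrier : Set
    _+_ : Carrier → Carrier → Carrier
    _*_ : Carrier → Carrier → Carrier
    -_  : Carrier → Carrier
    0#  : Carrier
    1#  : Carrier
    isCommutativeRing : IsCommutativeRing _≡_ _+_ _*_ -_ 0# 1#
    0≢1 : 0# ≢ 1#
    inverse : ∀ x → x ≢ 0# → Σ Carrier λ y → x * y ≡ 1#
    enumeration : Fin q ↔ Carrier

module Lambda {q : ℕ} (F : FiniteField q) where
  open FiniteField F

  Vector : ℕ → Set
  Vector k = Fin (suc k) → Carrier

  -- coordinate n of a vector (0 if out of range; only used in range)
  at : ∀ {k} → Vector k → ℕ → Carrier
  at {k} v n with n <? suc k
  ... | yes p = v (fromℕ< p)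
  ... | no _  = 0#

  _≐_ : ∀ {k} → Vector k → Vector k → Set
  v ≐ w = ∀ t → v t ≡ w t

  IsZeroVec : ∀ {k} → Vector k → Set
  IsZeroVec v = ∀ t → v t ≡ 0#

  InL : ∀ {k} → Vector k → Set
  InL l = at l 1 ≡ at l 2

  InR : ∀ {k} → Vector k → Set
  InR r = at r 1 ≡ 0#

  kind23 : ℕ → Bool
  kind23 2 = true
  kind23 3 = true
  kind23 _ = false

  Adj : ∀ {k} → Vector k → Vector k → Set
  Adj {k} l r = ∀ i → 2 ≤ i → i ≤ k →
    at l i + at r i ≡
      (if kind23 (i % 4) then at r 0 * at l (Data.Nat._∸_ i 2)
                         else at l 0 * at r (Data.Nat._∸_ i 2))

  next : ∀ {m} → Fin (suc m) → Fin (suc m)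
  next {m} i with suc (toℕ i) <? suc m
  ... | yes p = fromℕ< p
  ... | no _  = fzero

  -- A cycle of length 2n (n = suc m) in Λ_{k,q} through the edge joining the
  -- two zero vectors: [l(0)], ⟨r(0)⟩, [l(1)], ⟨r(1)⟩, ..., [l(m)], ⟨r(m)⟩
  -- (index j here corresponds to index j+1 in the paper).
  record Cycle (k m : ℕ) : Set where
    field
      l : Fin (suc m) → Vector k
      r : Fin (suc m) → Vector k
      l∈L : ∀ j → InL (l j)
      r∈R : ∀ j → InR (r j)
      l-zero : IsZeroVec (l fzero)
      r-zero : IsZeroVec (r fzero)
      l-distinct : ∀ i j → l i ≐ l j → i ≡ j
      r-distinct : ∀ i j → r i ≐ r j → i ≡ j
      adj-lr : ∀ j → Adj (l j) (r j)
      adj-rl : ∀ j → Adj (l (next j)) (r j)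

  -- x_j, y_j and the type (u, v): u_j = x_{j+1} - x_j, v_j = y_{j+1} - y_j,
  -- with x_{n+1} = y_{n+1} = 0, which equals x_1 = y_1 = 0 (cyclic successor).
  module _ {k m : ℕ} (C : Cycle k m) where
    open Cycle C
    x y u v : Fin (suc m) → Carrier
    x j = l j fzero
    y j = r j fzero
    u j = x (next j) + - x j
    v j = y (next j) + - y j

  HasCycleOfType : (k m : ℕ) → (Fin (suc m) → Carrier) → (Fin (suc m) → Carrier) → Set
  HasCycleOfType k m U V =
    Σ (Cycle k m) λ C → (∀ j → u C j ≡ U j) × (∀ j → v C j ≡ V j)

{-# OPTIONS --safe #-}
module Submission where

open import Defs
open import Data.Nat using (ℕ)
open import Data.Fin using (Fin; zero; suc)
open import Data.Product using (Σ; _×_)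
open import Relation.Binary.PropositionalEquality using (_≡_; _≢_)
open import Function.Bundles using (_⇔_)

open import Algebra.Bundles using (CommutativeRing; RawRing)
open import Algebra.Solver.Ring.AlmostCommutativeRing
  using (fromCommutativeRing; _-Raw-AlmostCommutative⟶_; Induced-equivalence)
open import Data.Bool using (T)
open import Data.Fin using (toℕ)
open import Data.Fin.Patterns
import Data.Fin.Properties as Fin
open import Data.Integer as ℤ using (ℤ; +_; -[1+_])
import Data.Integer.Properties as ℤ
import Data.Maybe as Maybe
open import Data.Nat as ℕ using (suc; z≤n; s≤s)
import Data.Nat.Properties as ℕ
open import Data.Product using (_,_; proj₁; proj₂)
open import Data.Sign as Sign using (Sign)
open import Data.Vec using (Vec; []; _∷_; lookup)
open import Data.Vec.Relation.Unary.All using ([]; _∷_)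
open import Data.Vec.Relation.Unary.Unique.Setoid.Properties using (lookup-injective)
open import Function.Bundles using (mk⇔)
open import Level using (0ℓ)
open import Relation.Binary.Consequences using (dec⇒weaklyDec)
open import Relation.Binary.Definitions using (WeaklyDecidable)
import Relation.Binary.PropositionalEquality as ≡
open import Relation.Binary.PropositionalEquality using (_→-setoid_)
open import Relation.Nullary using (¬_; yes; no)

-- In Λ₅ a vertex [l] has, for every y, exactly one neighbour ⟨r⟩ with r₀ = y, obtained by
-- solving the adjacency equations for r₂, …, r₅; symmetrically for ⟨r⟩. Hence a cycle
-- through the zero edge is determined by its sequences x and y: its last R-vertex is the
-- end of the walk from the zero vector along (x₁, y₁), …, (x₄, y₄) (indices shifted by one
-- with respect to the paper), and the cycle closes iff that vertex is adjacent to [0], i.e.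
-- iff four polynomial equations in the xᵢ, yᵢ hold. Two consecutive L-vertices share an
-- R-neighbour (and vice versa), so distinctness makes consecutive x's and consecutive y's
-- differ. With y₃ = y₁ (this is v₂ + v₃ = 0) the four equations, together with these
-- inequalities, force y₂ ≠ 0, x₄ = x₁, y₄ = y₁ + y₂ and two linear relations for x₂ and x₃,
-- which is the parametrisation with c = y₁ - y₂, d = y₂ and r = x₁ / c. Conversely, for
-- such c, d, r the walk closes up, and the nondegeneracy conditions separate the vertices.

-- The library solvers take their coefficients in the ring itself, where equality of
-- constants does not compute for an abstract field; integer coefficients do.
module IntegerCoefficientSolver {c ℓ} (R : CommutativeRing c ℓ) where
  open CommutativeRing R
  open import Algebra.Properties.Ring ring
  open import Algebra.Properties.Semiring.Mult semiring using (×-homo-+; ×1-homo-*)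
    renaming (_×_ to _·_)
  open import Relation.Binary.Reasoning.Setoid setoid

  ⟦_⟧ℤ : ℤ → Carrier
  ⟦ + n ⟧ℤ      = n · 1#
  ⟦ -[1+ n ] ⟧ℤ = - (suc n · 1#)

  signed : Sign → Carrier → Carrier
  signed Sign.+ x = x
  signed Sign.- x = - x

  signed-cong : ∀ s {x y} → x ≈ y → signed s x ≈ signed s y
  signed-cong Sign.+ x≈y = x≈y
  signed-cong Sign.- x≈y = -‿cong x≈y

  signed-* : ∀ s t x y → signed (s Sign.* t) (x * y) ≈ signed s x * signed t y
  signed-* Sign.+ Sign.+ x y = refl
  signed-* Sign.+ Sign.- x y = -‿distribʳ-* x y
  signed-* Sign.- Sign.+ x y = -‿distribˡ-* x y
  signed-* Sign.- Sign.- x y = begin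
    x * y        ≈⟨ -‿involutive _ ⟨
    - - (x * y)  ≈⟨ -‿cong (-‿distribˡ-* x y) ⟩
    - (- x * y)  ≈⟨ -‿distribʳ-* (- x) y ⟩
    - x * - y    ∎

  [1+x]-[1+y]≈x-y : ∀ x y → (1# + x) - (1# + y) ≈ x - y
  [1+x]-[1+y]≈x-y x y = begin
    (1# + x) - (1# + y)    ≈⟨ +-congˡ (-‿+-comm 1# y) ⟨
    (1# + x) + (- 1# - y)  ≈⟨ +-assoc 1# x _ ⟩
    1# + (x + (- 1# - y))  ≈⟨ +-congˡ (+-assoc x (- 1#) (- y)) ⟨
    1# + ((x - 1#) - y)    ≈⟨ +-congˡ (+-congʳ (+-comm x (- 1#))) ⟩
    1# + ((- 1# + x) - y)  ≈⟨ +-congˡ (+-assoc (- 1#) x (- y)) ⟩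
    1# + (- 1# + (x - y))  ≈⟨ +-assoc 1# (- 1#) _ ⟨
    (1# - 1#) + (x - y)    ≈⟨ +-congʳ (-‿inverseʳ 1#) ⟩
    0# + (x - y)           ≈⟨ +-identityˡ _ ⟩
    x - y                  ∎

  ⊖-homo : ∀ m n → ⟦ m ℤ.⊖ n ⟧ℤ ≈ m · 1# - n · 1#
  ⊖-homo 0       0       = sym (-‿inverseʳ 0#)
  ⊖-homo (suc m) 0       = sym (trans (+-congˡ -0#≈0#) (+-identityʳ _))
  ⊖-homo 0       (suc n) = sym (+-identityˡ _)
  ⊖-homo (suc m) (suc n) = begin
    ⟦ suc m ℤ.⊖ suc n ⟧ℤ     ≡⟨ ≡.cong ⟦_⟧ℤ (ℤ.[1+m]⊖[1+n]≡m⊖n m n) ⟩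
    ⟦ m ℤ.⊖ n ⟧ℤ             ≈⟨ ⊖-homo m n ⟩
    m · 1# - n · 1#          ≈⟨ [1+x]-[1+y]≈x-y _ _ ⟨
    suc m · 1# - suc n · 1#  ∎

  +-homo : ∀ i j → ⟦ i ℤ.+ j ⟧ℤ ≈ ⟦ i ⟧ℤ + ⟦ j ⟧ℤ
  +-homo (+ m)    (+ n)    = ×-homo-+ 1# m n
  +-homo (+ m)    -[1+ n ] = ⊖-homo m (suc n)
  +-homo -[1+ m ] (+ n)    = trans (⊖-homo n (suc m)) (+-comm _ _)
  +-homo -[1+ m ] -[1+ n ] = begin
    - (suc (suc (m ℕ.+ n)) · 1#)     ≡⟨ ≡.cong (λ k → - (suc k · 1#)) (ℕ.+-suc m n) ⟨
    - ((suc m ℕ.+ suc n) · 1#)       ≈⟨ -‿cong (×-homo-+ 1# (suc m) (suc n)) ⟩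
    - (suc m · 1# + suc n · 1#)      ≈⟨ -‿+-comm _ _ ⟨
    - (suc m · 1#) + - (suc n · 1#)  ∎

  -‿homo : ∀ i → ⟦ ℤ.- i ⟧ℤ ≈ - ⟦ i ⟧ℤ
  -‿homo -[1+ n ]    = sym (-‿involutive _)
  -‿homo (+ 0)       = sym -0#≈0#
  -‿homo (+ (suc n)) = refl

  ◃-homo : ∀ s n → ⟦ s ℤ.◃ n ⟧ℤ ≈ signed s (n · 1#)
  ◃-homo Sign.+ 0       = refl
  ◃-homo Sign.- 0       = sym -0#≈0#
  ◃-homo Sign.+ (suc n) = refl
  ◃-homo Sign.- (suc n) = refl

  *-homo : ∀ i j → ⟦ i ℤ.* j ⟧ℤ ≈ ⟦ i ⟧ℤ * ⟦ j ⟧ℤ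
  *-homo i j = begin
    ⟦ (s Sign.* t) ℤ.◃ (m ℕ.* n) ⟧ℤ        ≈⟨ ◃-homo (s Sign.* t) (m ℕ.* n) ⟩
    signed (s Sign.* t) ((m ℕ.* n) · 1#)   ≈⟨ signed-cong (s Sign.* t) (×1-homo-* m n) ⟩
    signed (s Sign.* t) (m · 1# * n · 1#)  ≈⟨ signed-* s t _ _ ⟩
    signed s (m · 1#) * signed t (n · 1#)  ≈⟨ *-cong (◃-homo s m) (◃-homo t n) ⟨
    ⟦ s ℤ.◃ m ⟧ℤ * ⟦ t ℤ.◃ n ⟧ℤ
      ≡⟨ ≡.cong₂ (λ i′ j′ → ⟦ i′ ⟧ℤ * ⟦ j′ ⟧ℤ) (ℤ.◃-inverse i) (ℤ.◃-inverse j) ⟩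
    ⟦ i ⟧ℤ * ⟦ j ⟧ℤ                        ∎
    where s = ℤ.sign i; t = ℤ.sign j; m = ℤ.∣ i ∣; n = ℤ.∣ j ∣

  ℤ⟶R : ℤ.+-*-rawRing -Raw-AlmostCommutative⟶ fromCommutativeRing R
  ℤ⟶R = record
    { ⟦_⟧    = ⟦_⟧ℤ
    ; +-homo = +-homo
    ; *-homo = *-homo
    ; -‿homo = -‿homo
    ; 0-homo = refl
    ; 1-homo = +-identityʳ 1#
    }

  ℤ-coefficient≟ : WeaklyDecidable (Induced-equivalence ℤ⟶R)
  ℤ-coefficient≟ i j = Maybe.map (λ { ≡.refl → refl }) (dec⇒weaklyDec ℤ._≟_ i j)

  open import Algebra.Solver.Ring ℤ.+-*-rawRing (fromCommutativeRing R) ℤ⟶R ℤ-coefficient≟ public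

  polynomialRing : ℕ → RawRing 0ℓ 0ℓ
  polynomialRing n = record
    { Carrier = Polynomial n ; _≈_ = _≡_
    ; _+_ = _:+_ ; _*_ = _:*_ ; -_ = :-_ ; 0# = con (+ 0) ; 1# = con (+ 1) }

-- Over raw rings, so that instantiating with polynomialRing turns every definition below
-- into a solver expression evaluating to the field-level one.
module Λ₅ {a ℓ} (ring : RawRing a ℓ) where
  open RawRing ring

  Point : Set a
  Point = Fin 6 → Carrier

  origin : Point
  origin _ = 0#

  -- the adjacency equations of Λ₅ solved for the unknown coordinates
  neighbourᴿ : Point → Carrier → Point
  neighbourᴿ l y 0F = y
  neighbourᴿ l y 1F = 0#
  neighbourᴿ l y 2F = y * l 0F + - l 2F
  neighbourᴿ l y 3F = y * l 1F + - l 3F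
  neighbourᴿ l y 4F = l 0F * neighbourᴿ l y 2F + - l 4F
  neighbourᴿ l y 5F = l 0F * neighbourᴿ l y 3F + - l 5F

  neighbourᴸ : Point → Carrier → Point
  neighbourᴸ r x 0F = x
  neighbourᴸ r x 1F = r 0F * x + - r 2F
  neighbourᴸ r x 2F = r 0F * x + - r 2F
  neighbourᴸ r x 3F = r 0F * neighbourᴸ r x 1F + - r 3F
  neighbourᴸ r x 4F = x * r 2F + - r 4F
  neighbourᴸ r x 5F = x * r 3F + - r 5F

  step : Point → Carrier → Carrier → Point
  step r x y = neighbourᴿ (neighbourᴸ r x) y

  walk⁴ : (x₁ y₁ x₂ y₂ x₃ y₃ x₄ y₄ : Carrier) → Point
  walk⁴ x₁ y₁ x₂ y₂ x₃ y₃ x₄ y₄ = step (step (step (step origin x₁ y₁) x₂ y₂) x₃ y₃) x₄ y₄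

  module StandardCycle (c d r : Carrier) where
    xs ys : Fin 5 → Carrier
    xs 0F = 0#
    xs 1F = c * r
    xs 2F = (c + d) * r
    xs 3F = - (d * r)
    xs 4F = c * r
    ys 0F = 0#
    ys 1F = c + d
    ys 2F = d
    ys 3F = c + d
    ys 4F = c + (d + d)

    L₁ R₁ L₂ R₂ L₃ R₃ L₄ R₄ : Point
    L₁ = neighbourᴸ origin (xs 1F)
    R₁ = neighbourᴿ L₁ (ys 1F)
    L₂ = neighbourᴸ R₁ (xs 2F)
    R₂ = neighbourᴿ L₂ (ys 2F)
    L₃ = neighbourᴸ R₂ (xs 3F)
    R₃ = neighbourᴿ L₃ (ys 3F)
    L₄ = neighbourᴸ R₃ (xs 4F)
    R₄ = neighbourᴿ L₄ (ys 4F)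

    Ls Rs : Vec Point 5
    Ls = origin ∷ L₁ ∷ L₂ ∷ L₃ ∷ L₄ ∷ []
    Rs = origin ∷ R₁ ∷ R₂ ∷ R₃ ∷ R₄ ∷ []

module InField {q : ℕ} (F : FiniteField q) where
  open FiniteField F
  open Lambda F
  open ≡ using (_≗_; refl; sym; trans; cong; cong₂; subst; subst₂; module ≡-Reasoning)

  commutativeRing : CommutativeRing 0ℓ 0ℓ
  commutativeRing = record { isCommutativeRing = isCommutativeRing }

  open CommutativeRing commutativeRing
    using (rawRing; +-comm; +-identityˡ; +-identityʳ; -‿inverseˡ; *-identityʳ; zeroˡ; zeroʳ)
  open import Algebra.Properties.Ring (CommutativeRing.ring commutativeRing)
    using (x≈z//y; x∙y⁻¹≈ε⇒x≈y; x≈y⇒x∙y⁻¹≈ε; -0#≈0#; -‿involutive; +-inverseˡ-unique)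
  open IntegerCoefficientSolver commutativeRing
    using (solve; _:=_; _:+_; _:-_; _:*_; :-_; con; polynomialRing)
  open Λ₅ rawRing
  module Poly {n} = Λ₅ (polynomialRing n)
  open import Data.Vec.Relation.Unary.Unique.Setoid (Fin 6 →-setoid Carrier) using (Unique; []; _∷_)

  ab≡0⇒b≡0 : ∀ {a b} → a ≢ 0# → a * b ≡ 0# → b ≡ 0#
  ab≡0⇒b≡0 {a} {b} a≢0 ab≡0 with inverse a a≢0
  ... | a⁻¹ , aa⁻¹≡1 = begin
    b              ≡⟨ sym (*-identityʳ b) ⟩
    b * 1#         ≡⟨ cong (b *_) (sym aa⁻¹≡1) ⟩
    b * (a * a⁻¹)  ≡⟨ solve 3 (λ a b a⁻¹ → b :* (a :* a⁻¹) := a⁻¹ :* (a :* b)) refl a b a⁻¹ ⟩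
    a⁻¹ * (a * b)  ≡⟨ cong (a⁻¹ *_) ab≡0 ⟩
    a⁻¹ * 0#       ≡⟨ zeroʳ a⁻¹ ⟩
    0#             ∎
    where open ≡-Reasoning

  *-≢0 : ∀ {a b} → a ≢ 0# → b ≢ 0# → a * b ≢ 0#
  *-≢0 a≢0 b≢0 ab≡0 = b≢0 (ab≡0⇒b≡0 a≢0 ab≡0)

  +-vanish : ∀ {a b} → a ≡ 0# → b ≡ 0# → a + b ≡ 0#
  +-vanish refl refl = +-identityʳ 0#

  *-vanish : ∀ c {a} → a ≡ 0# → c * a ≡ 0#
  *-vanish c refl = zeroʳ c

  -‿vanish : ∀ {a} → a ≡ 0# → - a ≡ 0#
  -‿vanish refl = -0#≈0#

  -‿≢0 : ∀ {a} → a ≢ 0# → - a ≢ 0#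
  -‿≢0 a≢0 -a≡0 = a≢0 (trans (sym (-‿involutive _)) (-‿vanish -a≡0))

  ≡⇒a-b≡0 : ∀ {a b} → a ≡ b → a + - b ≡ 0#
  ≡⇒a-b≡0 = x≈y⇒x∙y⁻¹≈ε

  a-b≡0⇒≡ : ∀ {a b} → a + - b ≡ 0# → a ≡ b
  a-b≡0⇒≡ = x∙y⁻¹≈ε⇒x≈y _ _

  -- The algebraic steps below are certificates: k * (a - b) is written, by the ring solver,
  -- as an explicit combination e of quantities already known to vanish.
  ≡-by-certificate : ∀ {k a b e} → k ≢ 0# → k * (a + - b) ≡ e → e ≡ 0# → a ≡ b
  ≡-by-certificate k≢0 certificate e≡0 = a-b≡0⇒≡ (ab≡0⇒b≡0 k≢0 (trans certificate e≡0))

  b≡c-a : ∀ {a b c} → a + b ≡ c → b ≡ c + - a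
  b≡c-a {a} {b} {c} a+b≡c = x≈z//y b a c (trans (+-comm b a) a+b≡c)

  a+[b-a]≡b : ∀ a b → a + (b + - a) ≡ b
  a+[b-a]≡b = solve 2 (λ a b → a :+ (b :- a) := b) refl

  [b-a]+a≡b : ∀ a b → (b + - a) + a ≡ b
  [b-a]+a≡b = solve 2 (λ a b → (b :- a) :+ a := b) refl

  -- Adjacency in Λ₅

  AdjEquations : Point → Point → Set
  AdjEquations l r =
    l 2F + r 2F ≡ r 0F * l 0F × l 3F + r 3F ≡ r 0F * l 1F ×
    l 4F + r 4F ≡ l 0F * r 2F × l 5F + r 5F ≡ l 0F * r 3F

  adj⇒equations : ∀ {l r} → Adj l r → AdjEquations l r
  adj⇒equations adj = adj 2 ≤! ≤! , adj 3 ≤! ≤! , adj 4 ≤! ≤! , adj 5 ≤! ≤!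
    where
    ≤! : ∀ {m n} {_ : T (m ℕ.≤ᵇ n)} → m ℕ.≤ n
    ≤! {m} {n} {m≤n} = ℕ.≤ᵇ⇒≤ m n m≤n

  equations⇒adj : ∀ {l r} → AdjEquations l r → Adj l r
  equations⇒adj _ 1 (s≤s ()) _
  equations⇒adj (e₂ , e₃ , e₄ , e₅) 2 _ _ = e₂
  equations⇒adj (e₂ , e₃ , e₄ , e₅) 3 _ _ = e₃
  equations⇒adj (e₂ , e₃ , e₄ , e₅) 4 _ _ = e₄
  equations⇒adj (e₂ , e₃ , e₄ , e₅) 5 _ _ = e₅
  equations⇒adj _ (suc (suc (suc (suc (suc (suc _)))))) _ (s≤s (s≤s (s≤s (s≤s (s≤s ())))))

  at-cong : ∀ {k} {v w : Vector k} → v ≐ w → ∀ n → at v n ≡ at w n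
  at-cong {k} v≐w n with n ℕ.<? suc k
  ... | yes _ = v≐w _
  ... | no _  = refl

  Adj-resp : ∀ {k} {l l′ r r′ : Vector k} → l ≐ l′ → r ≐ r′ → Adj l r → Adj l′ r′
  Adj-resp l≐l′ r≐r′ adj i 2≤i i≤k
    rewrite sym (at-cong l≐l′ i) | sym (at-cong r≐r′ i)
          | sym (at-cong l≐l′ 0) | sym (at-cong r≐r′ 0)
          | sym (at-cong l≐l′ (i ℕ.∸ 2)) | sym (at-cong r≐r′ (i ℕ.∸ 2)) = adj i 2≤i i≤k

  neighbourᴿ-adj : ∀ l y → Adj l (neighbourᴿ l y)
  neighbourᴿ-adj l y = equations⇒adj
    (a+[b-a]≡b _ _ , a+[b-a]≡b _ _ , a+[b-a]≡b _ _ , a+[b-a]≡b _ _)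

  neighbourᴸ-adj : ∀ r x → Adj (neighbourᴸ r x) r
  neighbourᴸ-adj r x = equations⇒adj
    ([b-a]+a≡b _ _ , [b-a]+a≡b _ _ , [b-a]+a≡b _ _ , [b-a]+a≡b _ _)

  neighbourᴿ-unique : ∀ {l r} → InR r → Adj l r → r ≐ neighbourᴿ l (r 0F)
  neighbourᴿ-unique {l} {r} r∈R adj with adj⇒equations adj
  ... | e₂ , e₃ , e₄ , e₅ = coordinate
    where
    coordinate : r ≐ neighbourᴿ l (r 0F)
    coordinate 0F = refl
    coordinate 1F = r∈R
    coordinate 2F = b≡c-a e₂
    coordinate 3F = b≡c-a e₃
    coordinate 4F = trans (b≡c-a e₄) (cong (λ t → l 0F * t + - l 4F) (coordinate 2F))
    coordinate 5F = trans (b≡c-a e₅) (cong (λ t → l 0F * t + - l 5F) (coordinate 3F))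

  neighbourᴸ-unique : ∀ {l r} → InL l → Adj l r → l ≐ neighbourᴸ r (l 0F)
  neighbourᴸ-unique {l} {r} l∈L adj with adj⇒equations adj
  ... | e₂ , e₃ , e₄ , e₅ = coordinate
    where
    coordinate : l ≐ neighbourᴸ r (l 0F)
    coordinate 0F = refl
    coordinate 1F = trans l∈L (coordinate 2F)
    coordinate 2F = x≈z//y _ _ _ e₂
    coordinate 3F = trans (x≈z//y _ _ _ e₃)
                          (cong (λ t → r 0F * t + - r 3F) (trans l∈L (coordinate 2F)))
    coordinate 4F = x≈z//y _ _ _ e₄
    coordinate 5F = x≈z//y _ _ _ e₅

  r₀-injective : ∀ {l r r′} → InR r → InR r′ → Adj l r → Adj l r′ → r 0F ≡ r′ 0F → r ≐ r′
  r₀-injective {l} r∈R r′∈R adj adj′ r₀≡r′₀ t =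
    trans (neighbourᴿ-unique r∈R adj t)
      (trans (cong (λ y → neighbourᴿ l y t) r₀≡r′₀) (sym (neighbourᴿ-unique r′∈R adj′ t)))

  l₀-injective : ∀ {l l′ r} → InL l → InL l′ → Adj l r → Adj l′ r → l 0F ≡ l′ 0F → l ≐ l′
  l₀-injective {r = r} l∈L l′∈L adj adj′ l₀≡l′₀ t =
    trans (neighbourᴸ-unique l∈L adj t)
      (trans (cong (λ x → neighbourᴸ r x t) l₀≡l′₀) (sym (neighbourᴸ-unique l′∈L adj′ t)))

  step-unique : ∀ {r w l r′} → r ≐ w → InL l → InR r′ → Adj l r → Adj l r′ →
                r′ ≐ step w (l 0F) (r′ 0F)
  step-unique {r} {w} {l} {r′} r≐w l∈L r′∈R adj adj′ =
    r₀-injective r′∈R refl (Adj-resp l≐l′ (λ _ → refl) adj′) (neighbourᴿ-adj l′ (r′ 0F)) refl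
    where
    l′ : Point
    l′ = neighbourᴸ w (l 0F)
    l≐l′ : l ≐ l′
    l≐l′ = l₀-injective l∈L refl adj
             (Adj-resp (λ _ → refl) (λ t → sym (r≐w t)) (neighbourᴸ-adj w (l 0F))) refl

  Closes : Point → Set
  Closes r = r 2F ≡ 0# × r 3F ≡ 0# × r 4F ≡ 0# × r 5F ≡ 0#

  origin-adj⇒closes : ∀ {r} → Adj origin r → Closes r
  origin-adj⇒closes adj with adj⇒equations adj
  ... | e₂ , e₃ , e₄ , e₅ =
    vanish e₂ (zeroʳ _) , vanish e₃ (zeroʳ _) , vanish e₄ (zeroˡ _) , vanish e₅ (zeroˡ _)
    where
    vanish : ∀ {a b} → 0# + a ≡ b → b ≡ 0# → a ≡ 0#
    vanish {a} 0+a≡b b≡0 = trans (sym (+-identityˡ a)) (trans 0+a≡b b≡0)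

  closes⇒origin-adj : ∀ {r} → Closes r → Adj origin r
  closes⇒origin-adj (c₂ , c₃ , c₄ , c₅) = equations⇒adj
    (vanish c₂ (zeroʳ _) , vanish c₃ (zeroʳ _) , vanish c₄ (zeroˡ _) , vanish c₅ (zeroˡ _))
    where
    vanish : ∀ {a b} → a ≡ 0# → b ≡ 0# → 0# + a ≡ b
    vanish {a} a≡0 b≡0 = trans (+-identityˡ a) (trans a≡0 (sym b≡0))

  next≢ : ∀ {m} (j : Fin (suc (suc m))) → next j ≢ j
  next≢ {m} j with suc (toℕ j) ℕ.<? suc (suc m)
  ... | yes j+1<n = λ next≡j → ℕ.1+n≢n (trans (sym (Fin.toℕ-fromℕ< j+1<n)) (cong toℕ next≡j))
  ... | no  j+1≮n = λ { refl → j+1≮n (s≤s (s≤s z≤n)) }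

  module _ {m} (C : Cycle 5 (suc m)) where
    open Cycle C

    x-next≢ : ∀ j → x C (next j) ≢ x C j
    x-next≢ j x≡ = next≢ j (l-distinct _ _
      (l₀-injective (l∈L (next j)) (l∈L j) (adj-rl j) (adj-lr j) x≡))

    y-next≢ : ∀ j → y C (next j) ≢ y C j
    y-next≢ j y≡ = next≢ j (r-distinct _ _
      (r₀-injective (r∈R (next j)) (r∈R j) (adj-lr (next j)) (adj-rl j) y≡))

  -- Closing walks

  closing-walk⇒y₂≢0 : ∀ {x₁ x₂ x₃ x₄ y₁ y₂ y₄} → Closes (walk⁴ x₁ y₁ x₂ y₂ x₃ y₁ x₄ y₄) →
    x₁ ≢ 0# → y₁ ≢ 0# → x₄ ≢ 0# → y₄ ≢ 0# → x₂ ≢ x₁ → y₂ ≢ 0#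
  closing-walk⇒y₂≢0 {x₁} {x₂} {x₃} {x₄} {y₁} {_} {y₄}
    closes@(w₂ , w₃ , _) x₁≢0 y₁≢0 x₄≢0 y₄≢0 x₂≢x₁ refl = x₂≢x₁ x₂≡x₁
    where
    y₄≡y₁ : y₄ ≡ y₁
    y₄≡y₁ = ≡-by-certificate (*-≢0 x₄≢0 y₄≢0)
      (solve 6 (λ x₁ x₂ x₃ x₄ y₁ y₄ → let w = Poly.walk⁴ x₁ y₁ x₂ (con (+ 0)) x₃ y₁ x₄ y₄ in
         (x₄ :* y₄) :* (y₄ :- y₁) := w 3F :- (y₁ :- y₄) :* w 2F)
        refl x₁ x₂ x₃ x₄ y₁ y₄)
      (+-vanish w₃ (-‿vanish (*-vanish _ w₂)))

    x₃≡x₂-x₁ : x₃ ≡ x₂ + - x₁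
    x₃≡x₂-x₁ =
      let w₂ , _ = subst (λ y → Closes (walk⁴ x₁ y₁ x₂ 0# x₃ y₁ x₄ y)) y₄≡y₁ closes in
      ≡-by-certificate y₁≢0
        (solve 5 (λ x₁ x₂ x₃ x₄ y₁ →
           y₁ :* (x₃ :- (x₂ :- x₁)) := Poly.walk⁴ x₁ y₁ x₂ (con (+ 0)) x₃ y₁ x₄ y₁ 2F)
          refl x₁ x₂ x₃ x₄ y₁)
        w₂

    x₂≡x₁ : x₂ ≡ x₁
    x₂≡x₁ =
      let _ , _ , w₄ , w₅ =
            subst₂ (λ x y → Closes (walk⁴ x₁ y₁ x₂ 0# x y₁ x₄ y)) x₃≡x₂-x₁ y₄≡y₁ closes in
      ≡-by-certificate (*-≢0 (*-≢0 y₁≢0 y₁≢0) x₁≢0)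
        (solve 4 (λ x₁ x₂ x₄ y₁ → let w = Poly.walk⁴ x₁ y₁ x₂ (con (+ 0)) (x₂ :- x₁) y₁ x₄ y₁ in
           (y₁ :* y₁ :* x₁) :* (x₂ :- x₁) := w 5F :- y₁ :* w 4F)
          refl x₁ x₂ x₄ y₁)
        (+-vanish w₅ (-‿vanish (*-vanish _ w₄)))

  module ClosingWalk {x₁ x₂ x₃ x₄ y₁ y₂ y₄ : Carrier}
    (closes : Closes (walk⁴ x₁ y₁ x₂ y₂ x₃ y₁ x₄ y₄))
    (x₁≢0 : x₁ ≢ 0#) (y₁≢0 : y₁ ≢ 0#) (y₂≢0 : y₂ ≢ 0#) (y₄≢0 : y₄ ≢ 0#) where

    x₄≡x₁ : x₄ ≡ x₁
    x₄≡x₁ =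
      let w₂ , w₃ , w₄ , w₅ = closes in
      sym (≡-by-certificate (*-≢0 x₁≢0 (*-≢0 y₁≢0 y₂≢0))
        (solve 7 (λ x₁ x₂ x₃ x₄ y₁ y₂ y₄ → let w = Poly.walk⁴ x₁ y₁ x₂ y₂ x₃ y₁ x₄ y₄ in
           (x₁ :* (y₁ :* y₂)) :* (x₁ :- x₄) :=
             (y₁ :+ y₂) :* w 4F :- (w 5F :+ w 5F) :- w 2F :* w 2F
             :+ x₄ :* (w 3F :- (y₁ :+ y₂ :- y₄) :* w 2F))
          refl x₁ x₂ x₃ x₄ y₁ y₂ y₄)
        (+-vanish (+-vanish (+-vanish (*-vanish _ w₄) (-‿vanish (+-vanish w₅ w₅)))
                            (-‿vanish (*-vanish _ w₂)))
                  (*-vanish x₄ (+-vanish w₃ (-‿vanish (*-vanish _ w₂))))))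

    y₄≡y₁+y₂ : y₄ ≡ y₁ + y₂
    y₄≡y₁+y₂ =
      let w₂ , w₃ , _ = subst (λ x → Closes (walk⁴ x₁ y₁ x₂ y₂ x₃ y₁ x y₄)) x₄≡x₁ closes in
      ≡-by-certificate (*-≢0 x₁≢0 y₄≢0)
        (solve 6 (λ x₁ x₂ x₃ y₁ y₂ y₄ → let w = Poly.walk⁴ x₁ y₁ x₂ y₂ x₃ y₁ x₁ y₄ in
           (x₁ :* y₄) :* (y₄ :- (y₁ :+ y₂)) := w 3F :- (y₁ :+ y₂ :- y₄) :* w 2F)
          refl x₁ x₂ x₃ y₁ y₂ y₄)
        (+-vanish w₃ (-‿vanish (*-vanish _ w₂)))

    closes′ : Closes (walk⁴ x₁ y₁ x₂ y₂ x₃ y₁ x₁ (y₁ + y₂))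
    closes′ = subst₂ (λ x y → Closes (walk⁴ x₁ y₁ x₂ y₂ x₃ y₁ x y)) x₄≡x₁ y₄≡y₁+y₂ closes

    [y₁-y₂][x₂-x₃]≡[y₁+y₂]x₁ : (y₁ + - y₂) * (x₂ + - x₃) ≡ (y₁ + y₂) * x₁
    [y₁-y₂][x₂-x₃]≡[y₁+y₂]x₁ = a-b≡0⇒≡ (trans
      (solve 5 (λ x₁ x₂ x₃ y₁ y₂ →
         (y₁ :- y₂) :* (x₂ :- x₃) :- (y₁ :+ y₂) :* x₁ :=
           :- Poly.walk⁴ x₁ y₁ x₂ y₂ x₃ y₁ x₁ (y₁ :+ y₂) 2F)
        refl x₁ x₂ x₃ y₁ y₂)
      (-‿vanish (proj₁ closes′)))

    [y₁-y₂]x₂≡y₁x₁ : (y₁ + - y₂) * x₂ ≡ y₁ * x₁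
    [y₁-y₂]x₂≡y₁x₁ =
      let w₂ , _ , w₄ , w₅ = closes′ in
      ≡-by-certificate (*-≢0 x₁≢0 (subst (_≢ 0#) y₄≡y₁+y₂ y₄≢0))
        (solve 5 (λ x₁ x₂ x₃ y₁ y₂ → let w = Poly.walk⁴ x₁ y₁ x₂ y₂ x₃ y₁ x₁ (y₁ :+ y₂) in
           (x₁ :* (y₁ :+ y₂)) :* ((y₁ :- y₂) :* x₂ :- y₁ :* x₁) :=
             w 5F :- y₁ :* w 4F :- (y₂ :- y₁) :* x₃ :* w 2F)
          refl x₁ x₂ x₃ y₁ y₂)
        (+-vanish (+-vanish w₅ (-‿vanish (*-vanish _ w₄))) (-‿vanish (*-vanish _ w₂)))

  typeU : (c d r : Carrier) → Fin 5 → Carrier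
  typeU c d r 0F = c * r
  typeU c d r 1F = d * r
  typeU c d r 2F = - ((c + (d + d)) * r)
  typeU c d r 3F = (c + d) * r
  typeU c d r 4F = - (c * r)

  typeV : (c d : Carrier) → Fin 5 → Carrier
  typeV c d 0F = c + d
  typeV c d 1F = - c
  typeV c d 2F = c
  typeV c d 3F = d
  typeV c d 4F = - c + - (d + d)

  module _ (c d r : Carrier) where
    open StandardCycle c d r

    standard-u : ∀ j → xs (next j) + - xs j ≡ typeU c d r j
    standard-u 0F = solve 2 (λ c r → c :* r :- con (+ 0) := c :* r) refl c r
    standard-u 1F = solve 3 (λ c d r → (c :+ d) :* r :- c :* r := d :* r) refl c d r
    standard-u 2F = solve 3 (λ c d r →
      :- (d :* r) :- (c :+ d) :* r := :- ((c :+ (d :+ d)) :* r)) refl c d r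
    standard-u 3F = solve 3 (λ c d r → c :* r :- :- (d :* r) := (c :+ d) :* r) refl c d r
    standard-u 4F = solve 2 (λ c r → con (+ 0) :- c :* r := :- (c :* r)) refl c r

    standard-v : ∀ j → ys (next j) + - ys j ≡ typeV c d j
    standard-v 0F = solve 2 (λ c d → (c :+ d) :- con (+ 0) := c :+ d) refl c d
    standard-v 1F = solve 2 (λ c d → d :- (c :+ d) := :- c) refl c d
    standard-v 2F = solve 2 (λ c d → (c :+ d) :- d := c) refl c d
    standard-v 3F = solve 2 (λ c d → (c :+ (d :+ d)) :- (c :+ d) := d) refl c d
    standard-v 4F = solve 2 (λ c d → con (+ 0) :- (c :+ (d :+ d)) := :- c :- (d :+ d)) refl c d

  record StandardType (U V : Fin 5 → Carrier) : Set where
    field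
      c d r : Carrier
      c≢0 : c ≢ 0#
      d≢0 : d ≢ 0#
      r≢0 : r ≢ 0#
      c≢-d : c ≢ - d
      c≢-2d : c ≢ - (d + d)
      U≗ : ∀ j → U j ≡ typeU c d r j
      V≗ : ∀ j → V j ≡ typeV c d j

  StandardType-resp : ∀ {U U′ V V′} → U ≗ U′ → V ≗ V′ → StandardType U V → StandardType U′ V′
  StandardType-resp U≗U′ V≗V′ T = record
    { StandardType T
    ; U≗ = λ j → trans (sym (U≗U′ j)) (U≗ j)
    ; V≗ = λ j → trans (sym (V≗V′ j)) (V≗ j)
    }
    where open StandardType T

  -- From a cycle to its parameters

  cycle-walk : (C : Cycle 5 4) → let open Cycle C in
    r 4F ≐ walk⁴ (x C 1F) (y C 1F) (x C 2F) (y C 2F) (x C 3F) (y C 3F) (x C 4F) (y C 4F)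
  cycle-walk C =
    step-unique (step-unique (step-unique (step-unique r-zero
      (l∈L 1F) (r∈R 1F) (adj-rl 0F) (adj-lr 1F))
      (l∈L 2F) (r∈R 2F) (adj-rl 1F) (adj-lr 2F))
      (l∈L 3F) (r∈R 3F) (adj-rl 2F) (adj-lr 3F))
      (l∈L 4F) (r∈R 4F) (adj-rl 3F) (adj-lr 4F)
    where open Cycle C

  cycle-closes : (C : Cycle 5 4) →
    Closes (walk⁴ (x C 1F) (y C 1F) (x C 2F) (y C 2F) (x C 3F) (y C 3F) (x C 4F) (y C 4F))
  cycle-closes C = origin-adj⇒closes (Adj-resp l-zero (cycle-walk C) (adj-rl 4F))
    where open Cycle C

  module CycleParameters (C : Cycle 5 4) (v₁+v₂≡0 : v C 1F + v C 2F ≡ 0#) where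
    open Cycle C hiding (r)

    x₁ x₂ x₃ x₄ y₁ y₂ y₃ y₄ : Carrier
    x₁ = x C 1F
    x₂ = x C 2F
    x₃ = x C 3F
    x₄ = x C 4F
    y₁ = y C 1F
    y₂ = y C 2F
    y₃ = y C 3F
    y₄ = y C 4F

    y₃≡y₁ : y₃ ≡ y₁
    y₃≡y₁ = a-b≡0⇒≡ (trans
      (solve 3 (λ y₁ y₂ y₃ → y₃ :- y₁ := (y₂ :- y₁) :+ (y₃ :- y₂)) refl y₁ y₂ y₃) v₁+v₂≡0)

    closes : Closes (walk⁴ x₁ y₁ x₂ y₂ x₃ y₁ x₄ y₄)
    closes = subst (λ y → Closes (walk⁴ x₁ y₁ x₂ y₂ x₃ y x₄ y₄)) y₃≡y₁ (cycle-closes C)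

    x₁≢0 : x₁ ≢ 0#
    x₁≢0 x₁≡0 = x-next≢ C 0F (trans x₁≡0 (sym (l-zero 0F)))

    y₁≢0 : y₁ ≢ 0#
    y₁≢0 y₁≡0 = y-next≢ C 0F (trans y₁≡0 (sym (r-zero 0F)))

    x₄≢0 : x₄ ≢ 0#
    x₄≢0 x₄≡0 = x-next≢ C 4F (trans (l-zero 0F) (sym x₄≡0))

    y₄≢0 : y₄ ≢ 0#
    y₄≢0 y₄≡0 = y-next≢ C 4F (trans (r-zero 0F) (sym y₄≡0))

    y₂≢0 : y₂ ≢ 0#
    y₂≢0 = closing-walk⇒y₂≢0 closes x₁≢0 y₁≢0 x₄≢0 y₄≢0 (x-next≢ C 1F)

    open ClosingWalk closes x₁≢0 y₁≢0 y₂≢0 y₄≢0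

    c : Carrier
    c = y₁ + - y₂

    c≢0 : c ≢ 0#
    c≢0 c≡0 = y-next≢ C 1F (sym (a-b≡0⇒≡ c≡0))

    c⁻¹ : Carrier
    c⁻¹ = proj₁ (inverse c c≢0)

    r : Carrier
    r = x₁ * c⁻¹

    cr≡x₁ : c * r ≡ x₁
    cr≡x₁ = begin
      c * (x₁ * c⁻¹)  ≡⟨ solve 3 (λ c x₁ c⁻¹ → c :* (x₁ :* c⁻¹) := x₁ :* (c :* c⁻¹)) refl c x₁ c⁻¹ ⟩
      x₁ * (c * c⁻¹)  ≡⟨ cong (x₁ *_) (proj₂ (inverse c c≢0)) ⟩
      x₁ * 1#         ≡⟨ *-identityʳ x₁ ⟩
      x₁              ∎
      where open ≡-Reasoning

    r≢0 : r ≢ 0#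
    r≢0 r≡0 = x₁≢0 (trans (sym cr≡x₁) (*-vanish c r≡0))

    c+d≡y₁ : c + y₂ ≡ y₁
    c+d≡y₁ = solve 2 (λ y₁ y₂ → (y₁ :- y₂) :+ y₂ := y₁) refl y₁ y₂

    c+2d≡y₄ : c + (y₂ + y₂) ≡ y₄
    c+2d≡y₄ = trans (solve 2 (λ y₁ y₂ → (y₁ :- y₂) :+ (y₂ :+ y₂) := y₁ :+ y₂) refl y₁ y₂)
                    (sym y₄≡y₁+y₂)

    c≢-d : c ≢ - y₂
    c≢-d c≡-d = y₁≢0 (trans (sym c+d≡y₁) (trans (cong (_+ y₂) c≡-d) (-‿inverseˡ y₂)))

    c≢-2d : c ≢ - (y₂ + y₂)
    c≢-2d c≡-2d =
      y₄≢0 (trans (sym c+2d≡y₄) (trans (cong (_+ (y₂ + y₂)) c≡-2d) (-‿inverseˡ (y₂ + y₂))))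

    open StandardCycle c y₂ r

    xs≗ : ∀ j → x C j ≡ xs j
    xs≗ 0F = l-zero 0F
    xs≗ 1F = sym cr≡x₁
    xs≗ 2F = ≡-by-certificate c≢0
      (solve 5 (λ x₁ x₂ y₁ y₂ r → let c = y₁ :- y₂ in
         c :* (x₂ :- (c :+ y₂) :* r) := (c :* x₂ :- y₁ :* x₁) :+ y₁ :* (x₁ :- c :* r))
        refl x₁ x₂ y₁ y₂ r)
      (+-vanish (≡⇒a-b≡0 [y₁-y₂]x₂≡y₁x₁) (*-vanish y₁ (≡⇒a-b≡0 (sym cr≡x₁))))
    xs≗ 3F = ≡-by-certificate c≢0
      (solve 6 (λ x₁ x₂ x₃ y₁ y₂ r → let c = y₁ :- y₂ in
         c :* (x₃ :- :- (y₂ :* r)) :=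
           (c :* x₂ :- y₁ :* x₁) :- (c :* (x₂ :- x₃) :- (y₁ :+ y₂) :* x₁) :- y₂ :* (x₁ :- c :* r))
        refl x₁ x₂ x₃ y₁ y₂ r)
      (+-vanish (+-vanish (≡⇒a-b≡0 [y₁-y₂]x₂≡y₁x₁) (-‿vanish (≡⇒a-b≡0 [y₁-y₂][x₂-x₃]≡[y₁+y₂]x₁)))
                (-‿vanish (*-vanish y₂ (≡⇒a-b≡0 (sym cr≡x₁)))))
    xs≗ 4F = trans x₄≡x₁ (sym cr≡x₁)

    ys≗ : ∀ j → y C j ≡ ys j
    ys≗ 0F = r-zero 0F
    ys≗ 1F = sym c+d≡y₁
    ys≗ 2F = refl
    ys≗ 3F = trans y₃≡y₁ (sym c+d≡y₁)
    ys≗ 4F = sym c+2d≡y₄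

    standardType : StandardType (u C) (v C)
    standardType = record
      { c = c ; d = y₂ ; r = r
      ; c≢0 = c≢0 ; d≢0 = y₂≢0 ; r≢0 = r≢0 ; c≢-d = c≢-d ; c≢-2d = c≢-2d
      ; U≗ = λ j → trans (cong₂ (λ a b → a + - b) (xs≗ (next j)) (xs≗ j)) (standard-u c y₂ r j)
      ; V≗ = λ j → trans (cong₂ (λ a b → a + - b) (ys≗ (next j)) (ys≗ j)) (standard-v c y₂ r j)
      }

  -- From the parameters to a cycle

  separated : ∀ {v w : Point} t {e} → w t + - v t ≡ e → e ≢ 0# → ¬ v ≐ w
  separated t difference e≢0 v≐w = e≢0 (trans (sym difference) (≡⇒a-b≡0 (sym (v≐w t))))

  module NondegenerateStandardCycle {c d r : Carrier} (c≢0 : c ≢ 0#) (d≢0 : d ≢ 0#)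
    (r≢0 : r ≢ 0#) (c+d≢0 : c + d ≢ 0#) (c+2d≢0 : c + (d + d) ≢ 0#) where
    open StandardCycle c d r

    cr≢0 : c * r ≢ 0#
    cr≢0 = *-≢0 c≢0 r≢0

    dr≢0 : d * r ≢ 0#
    dr≢0 = *-≢0 d≢0 r≢0

    [c+d]r≢0 : (c + d) * r ≢ 0#
    [c+d]r≢0 = *-≢0 c+d≢0 r≢0

    [c+2d]r≢0 : (c + (d + d)) * r ≢ 0#
    [c+2d]r≢0 = *-≢0 c+2d≢0 r≢0

    cr[c+2d]≢0 : c * (r * (c + (d + d))) ≢ 0#
    cr[c+2d]≢0 = *-≢0 c≢0 (*-≢0 r≢0 c+2d≢0)

    -- Vertices are told apart by their 0-th coordinate, except L₁, L₄ (x₁ = x₄) and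
    -- R₁, R₃ (y₁ = y₃).
    Ls-unique : Unique Ls
    Ls-unique =
      ( separated 0F (solve 2 (λ c r → c :* r :- con (+ 0) := c :* r) refl c r) cr≢0
      ∷ separated 0F (solve 3 (λ c d r → (c :+ d) :* r :- con (+ 0) := (c :+ d) :* r) refl c d r)
          [c+d]r≢0
      ∷ separated 0F (solve 2 (λ d r → :- (d :* r) :- con (+ 0) := :- (d :* r)) refl d r)
          (-‿≢0 dr≢0)
      ∷ separated 0F (solve 2 (λ c r → c :* r :- con (+ 0) := c :* r) refl c r) cr≢0
      ∷ [])
      ∷ ( separated 0F (solve 3 (λ c d r → (c :+ d) :* r :- c :* r := d :* r) refl c d r) dr≢0
        ∷ separated 0F (solve 3 (λ c d r → :- (d :* r) :- c :* r := :- ((c :+ d) :* r)) refl c d r)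
            (-‿≢0 [c+d]r≢0)
        ∷ separated 1F (solve 3 (λ c d r →
              Poly.StandardCycle.L₄ c d r 1F :- Poly.StandardCycle.L₁ c d r 1F :=
                c :* (r :* (c :+ (d :+ d))))
            refl c d r) cr[c+2d]≢0
        ∷ [])
      ∷ ( separated 0F (solve 3 (λ c d r →
              :- (d :* r) :- (c :+ d) :* r := :- ((c :+ (d :+ d)) :* r)) refl c d r)
            (-‿≢0 [c+2d]r≢0)
        ∷ separated 0F (solve 3 (λ c d r → c :* r :- (c :+ d) :* r := :- (d :* r)) refl c d r)
            (-‿≢0 dr≢0)
        ∷ [])
      ∷ ( separated 0F (solve 3 (λ c d r → c :* r :- :- (d :* r) := (c :+ d) :* r) refl c d r)
            [c+d]r≢0
        ∷ [])
      ∷ []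
      ∷ []

    Rs-unique : Unique Rs
    Rs-unique =
      ( separated 0F (solve 2 (λ c d → (c :+ d) :- con (+ 0) := c :+ d) refl c d) c+d≢0
      ∷ separated 0F (solve 1 (λ d → d :- con (+ 0) := d) refl d) d≢0
      ∷ separated 0F (solve 2 (λ c d → (c :+ d) :- con (+ 0) := c :+ d) refl c d) c+d≢0
      ∷ separated 0F (solve 2 (λ c d → (c :+ (d :+ d)) :- con (+ 0) := c :+ (d :+ d)) refl c d)
          c+2d≢0
      ∷ [])
      ∷ ( separated 0F (solve 2 (λ c d → d :- (c :+ d) := :- c) refl c d) (-‿≢0 c≢0)
        ∷ separated 2F (solve 3 (λ c d r →
              Poly.StandardCycle.R₃ c d r 2F :- Poly.StandardCycle.R₁ c d r 2F :=
                :- (c :* (r :* (c :+ (d :+ d)))))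
            refl c d r) (-‿≢0 cr[c+2d]≢0)
        ∷ separated 0F (solve 2 (λ c d → (c :+ (d :+ d)) :- (c :+ d) := d) refl c d) d≢0
        ∷ [])
      ∷ ( separated 0F (solve 2 (λ c d → (c :+ d) :- d := c) refl c d) c≢0
        ∷ separated 0F (solve 2 (λ c d → (c :+ (d :+ d)) :- d := c :+ d) refl c d) c+d≢0
        ∷ [])
      ∷ ( separated 0F (solve 2 (λ c d → (c :+ (d :+ d)) :- (c :+ d) := d) refl c d) d≢0
        ∷ [])
      ∷ []
      ∷ []

    R₄-closes : Closes R₄
    R₄-closes =
      ( solve 3 (λ c d r → Poly.StandardCycle.R₄ c d r 2F := con (+ 0)) refl c d r
      , solve 3 (λ c d r → Poly.StandardCycle.R₄ c d r 3F := con (+ 0)) refl c d r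
      , solve 3 (λ c d r → Poly.StandardCycle.R₄ c d r 4F := con (+ 0)) refl c d r
      , solve 3 (λ c d r → Poly.StandardCycle.R₄ c d r 5F := con (+ 0)) refl c d r )

    cycle : Cycle 5 4
    cycle = record
      { l = lookup Ls
      ; r = lookup Rs
      ; l∈L = λ { 0F → refl ; 1F → refl ; 2F → refl ; 3F → refl ; 4F → refl }
      ; r∈R = λ { 0F → refl ; 1F → refl ; 2F → refl ; 3F → refl ; 4F → refl }
      ; l-zero = λ _ → refl
      ; r-zero = λ _ → refl
      ; l-distinct = lookup-injective (Fin 6 →-setoid Carrier) Ls-unique
      ; r-distinct = lookup-injective (Fin 6 →-setoid Carrier) Rs-unique
      ; adj-lr = λ { 0F → closes⇒origin-adj (refl , refl , refl , refl)
                   ; 1F → neighbourᴿ-adj _ _ ; 2F → neighbourᴿ-adj _ _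
                   ; 3F → neighbourᴿ-adj _ _ ; 4F → neighbourᴿ-adj _ _ }
      ; adj-rl = λ { 0F → neighbourᴸ-adj _ _ ; 1F → neighbourᴸ-adj _ _
                   ; 2F → neighbourᴸ-adj _ _ ; 3F → neighbourᴸ-adj _ _
                   ; 4F → closes⇒origin-adj R₄-closes }
      }

    xs≗ : ∀ j → x cycle j ≡ xs j
    xs≗ 0F = refl
    xs≗ 1F = refl
    xs≗ 2F = refl
    xs≗ 3F = refl
    xs≗ 4F = refl

    ys≗ : ∀ j → y cycle j ≡ ys j
    ys≗ 0F = refl
    ys≗ 1F = refl
    ys≗ 2F = refl
    ys≗ 3F = refl
    ys≗ 4F = refl

  standardType⇒cycle : ∀ {U V} → StandardType U V → HasCycleOfType 5 4 U V
  standardType⇒cycle {U} {V} T = cycle , u≗U , v≗V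
    where
    open StandardType T

    c+d≢0 : c + d ≢ 0#
    c+d≢0 c+d≡0 = c≢-d (+-inverseˡ-unique c d c+d≡0)

    c+2d≢0 : c + (d + d) ≢ 0#
    c+2d≢0 c+2d≡0 = c≢-2d (+-inverseˡ-unique c (d + d) c+2d≡0)

    open NondegenerateStandardCycle c≢0 d≢0 r≢0 c+d≢0 c+2d≢0

    u≗U : ∀ j → u cycle j ≡ U j
    u≗U j = trans (cong₂ (λ a b → a + - b) (xs≗ (next j)) (xs≗ j))
                  (trans (standard-u c d r j) (sym (U≗ j)))

    v≗V : ∀ j → v cycle j ≡ V j
    v≗V j = trans (cong₂ (λ a b → a + - b) (ys≗ (next j)) (ys≗ j))
                  (trans (standard-v c d r j) (sym (V≗ j)))

lemma1 : (q : ℕ) → IsPrimePower q → (F : FiniteField q) →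
  let open FiniteField F
      open Lambda F
  in (U V : Fin 5 → Carrier) →
     V (suc zero) + V (suc (suc zero)) ≡ 0# →
     HasCycleOfType 5 4 U V ⇔
     Σ Carrier (λ c → Σ Carrier (λ d → Σ Carrier (λ r →
       c ≢ 0# × d ≢ 0# × r ≢ 0# × c ≢ - d × c ≢ - (d + d) ×
       V zero ≡ c + d × V (suc zero) ≡ - c × V (suc (suc zero)) ≡ c ×
       V (suc (suc (suc zero))) ≡ d × V (suc (suc (suc (suc zero)))) ≡ - c + - (d + d) ×
       U zero ≡ c * r × U (suc zero) ≡ d * r × U (suc (suc zero)) ≡ - ((c + (d + d)) * r) ×
       U (suc (suc (suc zero))) ≡ (c + d) * r × U (suc (suc (suc (suc zero)))) ≡ - (c * r))))
lemma1 _ _ F U V V₁+V₂≡0 = mk⇔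
  (λ (C , u≗U , v≗V) →
    let v₁+v₂≡0 = ≡.trans (≡.cong₂ _+_ (v≗V 1F) (v≗V 2F)) V₁+V₂≡0
        open StandardType (StandardType-resp u≗U v≗V (CycleParameters.standardType C v₁+v₂≡0))
    in c , d , r , c≢0 , d≢0 , r≢0 , c≢-d , c≢-2d ,
       V≗ 0F , V≗ 1F , V≗ 2F , V≗ 3F , V≗ 4F , U≗ 0F , U≗ 1F , U≗ 2F , U≗ 3F , U≗ 4F)
  (λ (c , d , r , c≢0 , d≢0 , r≢0 , c≢-d , c≢-2d , V₀ , V₁ , V₂ , V₃ , V₄ , U₀ , U₁ , U₂ , U₃ , U₄) →
    standardType⇒cycle record
      { c = c ; d = d ; r = r ; c≢0 = c≢0 ; d≢0 = d≢0 ; r≢0 = r≢0 ; c≢-d = c≢-d ; c≢-2d = c≢-2d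
      ; U≗ = λ { 0F → U₀ ; 1F → U₁ ; 2F → U₂ ; 3F → U₃ ; 4F → U₄ }
      ; V≗ = λ { 0F → V₀ ; 1F → V₁ ; 2F → V₂ ; 3F → V₃ ; 4F → V₄ }
      })
  where
  open FiniteField F using (_+_)
  open InField F
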